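{- Fix a finite request sequence $\sigma$, let $\mathrm{OPT}^*$ be the optimal offline algorithm defined in the context, and let $\mathrm{ALG}$ be the deterministic PivotTracking algorithm defined in the context, both starting from the same initial configuration. For every request $\sigma_i$ of $\sigma$: (1) $\mathrm{ALG}$ applies its intersection behavior on $\sigma_i$ if and only if $\mathrm{OPT}^*$ pays $1$ for $\sigma_i$; (2) $\mathrm{ALG}$ applies its union behavior on $\sigma_i$ if and only if $\mathrm{OPT}^*$ pays $2$ for $\sigma_i$, either by directly paying a serving cost of $2$ or by first migrating a node (cost $1$) and then paying a serving cost of $1$.
   Context: Problem: The host graph is a star on $n$ physical hosts: one central host at distance $1$ from every other host, and any two distinct non-central hosts at distance $2$. A set $X$ of $n$ guest nodes is mapped bijectively to the hosts; the guest node on the central host is the central node. From a given initial configuration, requests $\sigma_1,\sigma_2,\dots$ (each a pair of distinct guest nodes) must be served in order at cost equal to the host distance between the two requested nodes in the current configuration (cost $1$ if one is the central node, $2$ otherwise); at any time an algorithm may migrate a guest node to the center (swap with the current central node) at cost $1$. Total cost = serving + migration cost. A phase of an algorithm is a (maximal) set of consecutive requests during which the algorithm keeps the same central node. $\mathrm{OPT}^*$ is an optimal (minimum total cost) offline algorithm on $\sigma$ which, among all optimal offline algorithms, minimizes the lexicographic order of the reversed sequence of its phase lengths (first minimizes the length of the last phase, then of the penultimate phase, and so on), ties broken arbitrarily. Algorithm PivotTracking: Maintain a candidate set $\mathcal{C}$, initially $\{x_{\mathrm{init}}\}$ where $x_{\mathrm{init}}$ is the initial central node. When request $\sigma_t=\{x_1,x_2\}$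 is issued: if $\mathcal{C}\cap\sigma_t\neq\emptyset$ (intersection behavior), set $\mathcal{C}\gets\mathcal{C}\cap\sigma_t$, and if no node of $\mathcal{C}$ is currently the central node, migrate a node of $\mathcal{C}$ to the center, breaking ties by a fixed order; otherwise (union behavior) set $\mathcal{C}\gets\mathcal{C}\cup\sigma_t$. Then serve $\sigma_t$. -}

module Defs where

open import Data.Nat using (ℕ; zero; suc; _+_; _≤_; _<_; _≤ᵇ_)
open import Data.Bool using (Bool; true; false; if_then_else_; _∨_; _∧_)
open import Data.Fin using (Fin; toℕ)
open import Data.Fin.Properties using (_≟_)
open import Data.Fin.Subset using (Subset; ⁅_⁆; _∩_; _∪_)
open import Data.List using (List; []; _∷_; length; reverse)
open import Data.Vec using (Vec; []; _∷_; lookup; toList)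
open import Data.Product using (_×_; _,_; proj₁; proj₂)
open import Relation.Nullary using (¬_; does)
open import Relation.Binary.PropositionalEquality using (_≡_)

-- Guest nodes are Fin n. Since every migration swaps with the central node
-- and all serving costs depend only on which guest node is central, a
-- configuration is represented by its central node.

record Request (n : ℕ) : Set where
  constructor req
  field
    fst : Fin n
    snd : Fin n
    distinct : ¬ (fst ≡ snd)
open Request public

_==_ : ∀ {n} → Fin n → Fin n → Bool
x == y = does (x ≟ y)

serveCost : ∀ {n} → Fin n → Request n → ℕ
serveCost c r = if (c == fst r) ∨ (c == snd r) then 1 else 2

-- Offline algorithms: for each request, the list of guest nodes migrated
-- to the center (in order, each at cost 1) just before serving it.

Schedule : ℕ → ℕ → Set
Schedule n m = Vec (List (Fin n)) m

afterMigs : ∀ {n} → Fin n → List (Fin n) → Fin n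
afterMigs c [] = c
afterMigs c (x ∷ xs) = afterMigs x xs

centers : ∀ {n m} → Fin n → Schedule n m → Vec (Fin n) m
centers c [] = []
centers c (ms ∷ S) = afterMigs c ms ∷ centers (afterMigs c ms) S

migCost : ∀ {n m} → Schedule n m → Fin m → ℕ
migCost S i = length (lookup S i)

servCost : ∀ {n m} → Fin n → Vec (Request n) m → Schedule n m → Fin m → ℕ
servCost init σ S i = serveCost (lookup (centers init S) i) (lookup σ i)

reqCost : ∀ {n m} → Fin n → Vec (Request n) m → Schedule n m → Fin m → ℕ
reqCost init σ S i = migCost S i + servCost init σ S i

totalCost : ∀ {n m} → Fin n → Vec (Request n) m → Schedule n m → ℕ
totalCost c [] [] = 0
totalCost c (r ∷ σ) (ms ∷ S) =
  length ms + serveCost (afterMigs c ms) r + totalCost (afterMigs c ms) σ S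

-- Phases: maximal runs of consecutive requests served with the same
-- central node; phaseLengths lists their lengths in order.

phaseGo : ∀ {n} → Fin n → ℕ → List (Fin n) → List ℕ
phaseGo c k [] = k ∷ []
phaseGo c k (d ∷ ds) = if c == d then phaseGo c (suc k) ds else k ∷ phaseGo d 1 ds

phaseLengths : ∀ {n} → List (Fin n) → List ℕ
phaseLengths [] = []
phaseLengths (c ∷ cs) = phaseGo c 1 cs

revPhaseLengths : ∀ {n m} → Fin n → Schedule n m → List ℕ
revPhaseLengths init S = reverse (phaseLengths (toList (centers init S)))

data _≤lex_ : List ℕ → List ℕ → Set where
  []≤ : ∀ {ys} → [] ≤lex ys
  <≤  : ∀ {x y xs ys} → x < y → (x ∷ xs) ≤lex (y ∷ ys)
  ≡≤  : ∀ {x xs ys} → xs ≤lex ys → (x ∷ xs) ≤lex (x ∷ ys)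

IsOPT* : ∀ {n m} → Fin n → Vec (Request n) m → Schedule n m → Set
IsOPT* {n} {m} init σ S =
  ((S' : Schedule n m) → totalCost init σ S ≤ totalCost init σ S') ×
  ((S' : Schedule n m) → totalCost init σ S' ≡ totalCost init σ S →
     revPhaseLengths init S ≤lex revPhaseLengths init S')

data Behaviour : Set where
  intersection union : Behaviour

reqSet : ∀ {n} → Request n → Subset n
reqSet r = ⁅ fst r ⁆ ∪ ⁅ snd r ⁆

-- node of C' (⊆ {a,b}) chosen by the fixed order (smallest index)
pick : ∀ {n} → Subset n → Request n → Fin n
pick C r =
  if lookup C (fst r) ∧ lookup C (snd r)
  then (if toℕ (fst r) ≤ᵇ toℕ (snd r) then fst r else snd r)
  else (if lookup C (fst r) then fst r else snd r)

pivotStep : ∀ {n} → Subset n → Fin n → Request n → Behaviour × Subset n × Fin n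
pivotStep C c r =
  if lookup C (fst r) ∨ lookup C (snd r)
  then (let C' = C ∩ reqSet r in
        intersection , C' , (if lookup C' c then c else pick C' r))
  else (union , C ∪ reqSet r , c)

pivotRun : ∀ {n m} → Subset n → Fin n → Vec (Request n) m → Vec Behaviour m
pivotRun C c [] = []
pivotRun C c (r ∷ σ) with pivotStep C c r
... | b , C' , c' = b ∷ pivotRun C' c' σ

pivotBehaviour : ∀ {n m} → Fin n → Vec (Request n) m → Vec Behaviour m
pivotBehaviour init σ = pivotRun ⁅ init ⁆ init σ

{-# OPTIONS --safe #-}
module Submission where

-- PivotTracking charges itself 1 for an intersection and 2 for a union. With the potential
-- "1 if the central node is not a candidate, else 0", every schedule pays on each request at
-- least the charge plus the increase of the potential, so the total charge bounds every schedule
-- from below; choosing central nodes among the candidate sets from the last request backwards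
-- gives a schedule paying exactly the charge and ending at any prescribed final candidate. Hence
-- OPT* pays exactly the total charge, and, peeling requests off the end, exactly the charge on
-- every prefix and so on every request. Peeling only fails at a union request that OPT* serves
-- without migrating, from a requested central node, after a prefix paid one above its charge.
-- There a cheapest prefix ending at a candidate, followed by one migration, is as cheap but
-- starts a new phase at that request, contradicting the lexicographic choice of OPT*.

open import Defs
open import Data.Nat using (ℕ; suc; _+_; _≤_; _<_; z≤n; s≤s)
open import Data.Nat.Properties hiding (_≟_)
open import Data.Bool using (Bool; true; false; if_then_else_; _∨_; _∧_)
open import Data.Bool.Properties using (∨-zeroʳ; if-float)
open import Data.Fin using (Fin; zero; suc; toℕ)
open import Data.Fin.Properties using (_≟_)
open import Data.Fin.Subset using (Subset; ⁅_⁆; _∩_; _∪_)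
open import Data.List using (List; []; _∷_; [_]; length; reverse; map; take; drop; _++_)
open import Data.List.Properties
  using (∷-injective; map-++; take-map; ++-assoc; ++-identityʳ; reverse-++; unfold-reverse)
open import Data.Vec using (Vec; []; _∷_; lookup; toList; zip)
open import Data.Vec.Properties using (lookup-zipWith; lookup-zip; lookup-replicate)
open import Data.Product using (_×_; _,_; proj₁; proj₂; ∃; ∃₂)
open import Data.Sum using (_⊎_; inj₁; inj₂)
open import Function using (_∘_)
open import Function.Bundles using (_⇔_; mk⇔)
open import Relation.Nullary using (¬_; yes; no; contradiction)
open import Relation.Nullary.Decidable using (dec-true; dec-false)
open import Relation.Binary.PropositionalEquality hiding ([_])

private variable
  n m : ℕ
  A : Set

==-refl : (x : Fin n) → x == x ≡ true
==-refl x = dec-true (x ≟ x) refl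

==⇒≡ : {x y : Fin n} → x == y ≡ true → x ≡ y
==⇒≡ {x = x} {y} eq with x ≟ y
... | yes x≡y = x≡y

≢⇒==-false : {x y : Fin n} → x ≢ y → x == y ≡ false
≢⇒==-false {x = x} {y} = dec-false (x ≟ y)

lookup-⁅⁆ : (a x : Fin n) → lookup ⁅ a ⁆ x ≡ x == a
lookup-⁅⁆ zero    zero    = refl
lookup-⁅⁆ zero    (suc x) = lookup-replicate x false
lookup-⁅⁆ (suc a) zero    = refl
lookup-⁅⁆ (suc a) (suc x) = lookup-⁅⁆ a x

lookup-⁅⁆-self : (a : Fin n) → lookup ⁅ a ⁆ a ≡ true
lookup-⁅⁆-self a = trans (lookup-⁅⁆ a a) (==-refl a)

lookup-⁅⁆⇒≡ : {a x : Fin n} → lookup ⁅ a ⁆ x ≡ true → x ≡ a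
lookup-⁅⁆⇒≡ {a = a} {x} x∈ = ==⇒≡ (trans (sym (lookup-⁅⁆ a x)) x∈)

-- Candidate sets of PivotTracking

requested : Request n → Fin n → Bool
requested r x = x == fst r ∨ x == snd r

intersects : Subset n → Request n → Bool
intersects C r = lookup C (fst r) ∨ lookup C (snd r)

nextCandidates : Subset n → Request n → Subset n
nextCandidates C r = if intersects C r then C ∩ reqSet r else C ∪ reqSet r

candidates : Subset n → List (Request n) → Subset n
candidates C []      = C
candidates C (r ∷ α) = candidates (nextCandidates C r) α

behaviour : Bool → Behaviour
behaviour b = if b then intersection else union

-- serveCost c r unfolds to price (requested r c).
price : Bool → ℕ
price b = if b then 1 else 2

pivotCost : Subset n → List (Request n) → ℕ
pivotCost C []      = 0
pivotCost C (r ∷ α) = price (intersects C r) + pivotCost (nextCandidates C r) α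

pivotStep-behaviour : ∀ C c (r : Request n) → proj₁ (pivotStep C c r) ≡ behaviour (intersects C r)
pivotStep-behaviour C c r = if-float proj₁ (intersects C r)

pivotStep-candidates : ∀ C c (r : Request n) → proj₁ (proj₂ (pivotStep C c r)) ≡ nextCandidates C r
pivotStep-candidates {n} C c r =
  if-float (λ (t : Behaviour × Subset n × Fin n) → proj₁ (proj₂ t)) (intersects C r)

lookup-reqSet : (r : Request n) (x : Fin n) → lookup (reqSet r) x ≡ requested r x
lookup-reqSet r x = trans (lookup-zipWith _∨_ x ⁅ fst r ⁆ ⁅ snd r ⁆)
                          (cong₂ _∨_ (lookup-⁅⁆ (fst r) x) (lookup-⁅⁆ (snd r) x))

lookup-∩-reqSet : ∀ C r (x : Fin n) → lookup (C ∩ reqSet r) x ≡ lookup C x ∧ requested r x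
lookup-∩-reqSet C r x =
  trans (lookup-zipWith _∧_ x C (reqSet r)) (cong (lookup C x ∧_) (lookup-reqSet r x))

lookup-∪-reqSet : ∀ C r (x : Fin n) → lookup (C ∪ reqSet r) x ≡ lookup C x ∨ requested r x
lookup-∪-reqSet C r x =
  trans (lookup-zipWith _∨_ x C (reqSet r)) (cong (lookup C x ∨_) (lookup-reqSet r x))

lookup-nextCandidates : ∀ C r (x : Fin n) → lookup (nextCandidates C r) x ≡
  (if intersects C r then lookup C x ∧ requested r x else lookup C x ∨ requested r x)
lookup-nextCandidates C r x with intersects C r
... | true  = lookup-∩-reqSet C r x
... | false = lookup-∪-reqSet C r x

requested-candidate⇒intersects : ∀ C r {x : Fin n} →
  requested r x ≡ true → lookup C x ≡ true → intersects C r ≡ true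
requested-candidate⇒intersects C r {x} x-req x∈C with x ≟ fst r | x ≟ snd r
... | yes refl | _      rewrite x∈C = refl
... | no _     | yes refl rewrite x∈C = ∨-zeroʳ _

candidate-unrequested : ∀ C r {x : Fin n} →
  intersects C r ≡ false → lookup C x ≡ true → requested r x ≡ false
candidate-unrequested C r {x} miss x∈C with requested r x in x-req
... | false = refl
... | true with () ← trans (sym (requested-candidate⇒intersects C r x-req x∈C)) miss

intersects⇒requested-candidate : ∀ C (r : Request n) →
  intersects C r ≡ true → ∃ λ x → lookup C x ≡ true × requested r x ≡ true
intersects⇒requested-candidate C r hit with lookup C (fst r) in fst∈C
... | true  = fst r , fst∈C , cong (_∨ (fst r == snd r)) (==-refl (fst r))
... | false = snd r , hit , trans (cong ((snd r == fst r) ∨_) (==-refl (snd r))) (∨-zeroʳ _)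

nextCandidates-nonempty : ∀ C r {z : Fin n} → lookup C z ≡ true →
  ∃ λ z′ → lookup (nextCandidates C r) z′ ≡ true
nextCandidates-nonempty C r {z} z∈C with intersects C r in hit
... | true  = let x , x∈C , x-req = intersects⇒requested-candidate C r hit
              in x , trans (lookup-∩-reqSet C r x) (cong₂ _∧_ x∈C x-req)
... | false = z , trans (lookup-∪-reqSet C r z) (cong (_∨ _) z∈C)

candidates-nonempty : ∀ C α {z : Fin n} → lookup C z ≡ true →
  ∃ λ y → lookup (candidates C α) y ≡ true
candidates-nonempty C []      z∈C = _ , z∈C
candidates-nonempty C (r ∷ α) z∈C =
  candidates-nonempty (nextCandidates C r) α (proj₂ (nextCandidates-nonempty C r z∈C))

lookup-pivotRun : ∀ C p (σ : Vec (Request n) m) i →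
  lookup (pivotRun C p σ) i ≡
  behaviour (intersects (candidates C (take (toℕ i) (toList σ))) (lookup σ i))
lookup-pivotRun C p (r ∷ σ) zero    = pivotStep-behaviour C p r
lookup-pivotRun C p (r ∷ σ) (suc i) =
  trans (lookup-pivotRun _ _ σ i)
        (cong (λ D → behaviour (intersects (candidates D (take (toℕ i) (toList σ))) (lookup σ i)))
              (pivotStep-candidates C p r))

Step : ℕ → Set
Step n = Request n × List (Fin n)

requests : List (Step n) → List (Request n)
requests = map proj₁

stepCost : Fin n → Step n → ℕ
stepCost c (r , ms) = length ms + serveCost (afterMigs c ms) r

costOf : Fin n → List (Step n) → ℕ
costOf c []               = 0
costOf c ((r , ms) ∷ ps) = stepCost c (r , ms) + costOf (afterMigs c ms) ps

finalCenter : Fin n → List (Step n) → Fin n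
finalCenter c []              = c
finalCenter c ((_ , ms) ∷ ps) = finalCenter (afterMigs c ms) ps

centersOf : Fin n → List (Step n) → List (Fin n)
centersOf c []              = []
centersOf c ((_ , ms) ∷ ps) = afterMigs c ms ∷ centersOf (afterMigs c ms) ps

costOf-++ : ∀ c (ps qs : List (Step n)) → costOf c (ps ++ qs) ≡ costOf c ps + costOf (finalCenter c ps) qs
costOf-++ c []               qs = refl
costOf-++ c ((r , ms) ∷ ps) qs = trans (cong (stepCost c (r , ms) +_) (costOf-++ (afterMigs c ms) ps qs))
                                        (sym (+-assoc (stepCost c (r , ms)) _ _))

costOf-snoc : ∀ c (ps : List (Step n)) p →
  costOf c (ps ++ [ p ]) ≡ costOf c ps + stepCost (finalCenter c ps) p
costOf-snoc c ps p = trans (costOf-++ c ps [ p ]) (cong (costOf c ps +_) (+-identityʳ _))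

pivotCost-snoc : ∀ C (α : List (Request n)) r →
  pivotCost C (α ++ [ r ]) ≡ pivotCost C α + price (intersects (candidates C α) r)
pivotCost-snoc C []      r = +-identityʳ _
pivotCost-snoc C (s ∷ α) r =
  trans (cong (price (intersects C s) +_) (pivotCost-snoc (nextCandidates C s) α r))
        (sym (+-assoc (price (intersects C s)) _ _))

centersOf-++ : ∀ c (ps qs : List (Step n)) →
  centersOf c (ps ++ qs) ≡ centersOf c ps ++ centersOf (finalCenter c ps) qs
centersOf-++ c []              qs = refl
centersOf-++ c ((_ , ms) ∷ ps) qs = cong (afterMigs c ms ∷_) (centersOf-++ (afterMigs c ms) ps qs)

-- afterMigs c xs is the last element of c ∷ xs.
afterMigs-centersOf : ∀ c (ps : List (Step n)) → afterMigs c (centersOf c ps) ≡ finalCenter c ps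
afterMigs-centersOf c []              = refl
afterMigs-centersOf c ((_ , ms) ∷ ps) = afterMigs-centersOf (afterMigs c ms) ps

totalCost-costOf : ∀ c (σ : Vec (Request n) m) S → totalCost c σ S ≡ costOf c (toList (zip σ S))
totalCost-costOf c []      []       = refl
totalCost-costOf c (r ∷ σ) (ms ∷ S) =
  cong (stepCost c (r , ms) +_) (totalCost-costOf (afterMigs c ms) σ S)

toList-centers : ∀ c (σ : Vec (Request n) m) S → toList (centers c S) ≡ centersOf c (toList (zip σ S))
toList-centers c []      []       = refl
toList-centers c (r ∷ σ) (ms ∷ S) = cong (afterMigs c ms ∷_) (toList-centers (afterMigs c ms) σ S)

requests-zip : ∀ (σ : Vec (Request n) m) S → requests (toList (zip σ S)) ≡ toList σ
requests-zip []      []       = refl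
requests-zip (r ∷ σ) (_ ∷ S) = cong (r ∷_) (requests-zip σ S)

schedule-from-steps : (σ : Vec (Request n) m) (ps : List (Step n)) → requests ps ≡ toList σ →
  ∃ λ (S : Schedule n m) → toList (zip σ S) ≡ ps
schedule-from-steps []      []               _  = [] , refl
schedule-from-steps (r ∷ σ) ((r′ , ms) ∷ ps) eq with ∷-injective eq
... | refl , eq′ = let S , zipS = schedule-from-steps σ ps eq′ in ms ∷ S , cong ((r , ms) ∷_) zipS

toList-split : (xs : Vec A m) (i : Fin m) →
  toList xs ≡ take (toℕ i) (toList xs) ++ lookup xs i ∷ drop (suc (toℕ i)) (toList xs)
toList-split (x ∷ xs) zero    = refl
toList-split (x ∷ xs) (suc i) = cong (x ∷_) (toList-split xs i)

lookup-centers : ∀ c (σ : Vec (Request n) m) S i →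
  lookup (centers c S) i ≡ afterMigs (finalCenter c (take (toℕ i) (toList (zip σ S)))) (lookup S i)
lookup-centers c (r ∷ σ) (ms ∷ S) zero    = refl
lookup-centers c (r ∷ σ) (ms ∷ S) (suc i) = lookup-centers (afterMigs c ms) σ S i

-- PivotTracking's charge is the optimal cost

penalty : Bool → ℕ
penalty b = if b then 0 else 1

idle-step : ∀ h u v → (h ≡ false → u ≡ true → v ≡ false) →
  price h + penalty (if h then u ∧ v else u ∨ v) ≤ penalty u + price v
idle-step true  true  true  _ = ≤-refl
idle-step true  true  false _ = ≤-refl
idle-step true  false true  _ = ≤-refl
idle-step true  false false _ = n≤1+n 2
idle-step false true  true  k with () ← k refl refl
idle-step false true  false _ = ≤-refl
idle-step false false true  _ = ≤-refl
idle-step false false false _ = ≤-refl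

moving-step : ∀ h u v → price h + penalty (if h then u ∧ v else u ∨ v) ≤ suc (price v)
moving-step true  true  true  = n≤1+n 1
moving-step true  true  false = n≤1+n 2
moving-step true  false true  = ≤-refl
moving-step true  false false = n≤1+n 2
moving-step false true  true  = ≤-refl
moving-step false false true  = ≤-refl
moving-step false true  false = n≤1+n 2
moving-step false false false = ≤-refl

potential-step : ∀ C r c (ms : List (Fin n)) →
  price (intersects C r) + penalty (lookup (nextCandidates C r) (afterMigs c ms)) ≤
  penalty (lookup C c) + stepCost c (r , ms)
potential-step C r c [] rewrite lookup-nextCandidates C r c =
  idle-step (intersects C r) (lookup C c) (requested r c) (candidate-unrequested C r)
potential-step {n} C r c (z ∷ zs) rewrite lookup-nextCandidates C r (afterMigs z zs) = begin
  price h + penalty _                           ≤⟨ moving-step h (lookup C x) (requested r x) ⟩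
  suc (price (requested r x))                   ≤⟨ s≤s (m≤n+m _ (length zs)) ⟩
  stepCost c (r , z ∷ zs)                       ≤⟨ m≤n+m _ (penalty (lookup C c)) ⟩
  penalty (lookup C c) + stepCost c (r , z ∷ zs) ∎
  where
  open ≤-Reasoning
  h : Bool
  h = intersects C r
  x : Fin n
  x = afterMigs z zs

pivotCost-potential : ∀ C c (ps : List (Step n)) →
  pivotCost C (requests ps) + penalty (lookup (candidates C (requests ps)) (finalCenter c ps)) ≤
  penalty (lookup C c) + costOf c ps
pivotCost-potential C c [] = ≤-reflexive (sym (+-identityʳ _))
pivotCost-potential {n} C c ((r , ms) ∷ ps) = begin
  Δ + M + end                          ≡⟨ +-assoc Δ M end ⟩
  Δ + (M + end)                        ≤⟨ +-monoʳ-≤ Δ (pivotCost-potential C′ c′ ps) ⟩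
  Δ + (penalty (lookup C′ c′) + K)     ≡⟨ +-assoc Δ _ K ⟨
  Δ + penalty (lookup C′ c′) + K       ≤⟨ +-monoˡ-≤ K (potential-step C r c ms) ⟩
  penalty (lookup C c) + stepCost c (r , ms) + K ≡⟨ +-assoc (penalty (lookup C c)) _ K ⟩
  penalty (lookup C c) + costOf c ((r , ms) ∷ ps) ∎
  where
  open ≤-Reasoning
  C′ : Subset n
  C′ = nextCandidates C r
  c′ : Fin n
  c′ = afterMigs c ms
  Δ M end K : ℕ
  Δ = price (intersects C r)
  M = pivotCost C′ (requests ps)
  end = penalty (lookup (candidates C′ (requests ps)) (finalCenter c′ ps))
  K = costOf c′ ps

pivotCost-≤-costOf : ∀ {C} {c : Fin n} → lookup C c ≡ true → ∀ ps →
  pivotCost C (requests ps) ≤ costOf c ps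
pivotCost-≤-costOf {C = C} {c} c∈C ps = ≤-trans (m≤m+n _ _) (≤-trans (pivotCost-potential C c ps)
  (≤-reflexive (cong (λ b → penalty b + costOf c ps) c∈C)))

reach-step : ∀ C r {z₀ z₁ : Fin n} → lookup C z₀ ≡ true → lookup (nextCandidates C r) z₁ ≡ true →
  ∃₂ λ z ms → lookup C z ≡ true × afterMigs z ms ≡ z₁ × stepCost z (r , ms) ≡ price (intersects C r)
reach-step C r {z₀} {z₁} z₀∈C z₁∈C′
  with intersects C r in hit | lookup C z₁ in z₁∈C | requested r z₁ in z₁-req
     | trans (sym (lookup-nextCandidates C r z₁)) z₁∈C′
... | true  | true  | true  | _ = z₁ , [] , z₁∈C , refl , cong price z₁-req
... | false | true  | _     | _ =
  z₁ , [] , z₁∈C , refl , cong price (candidate-unrequested C r hit z₁∈C)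
... | false | false | true  | _ = z₀ , z₁ ∷ [] , z₀∈C , refl , cong (suc ∘ price) z₁-req

optimal-steps : ∀ C α {z₀ : Fin n} → lookup C z₀ ≡ true → ∀ {y} → lookup (candidates C α) y ≡ true →
  ∃₂ λ z ps → lookup C z ≡ true × requests ps ≡ α × costOf z ps ≡ pivotCost C α × finalCenter z ps ≡ y
optimal-steps C [] _ {y} y∈C = y , [] , y∈C , refl , refl , refl
optimal-steps C (r ∷ α) z₀∈C y∈
  with nextCandidates-nonempty C r z₀∈C
... | z₁ , z₁∈ with optimal-steps (nextCandidates C r) α z₁∈ y∈
... | w , ps , w∈ , reqs , cost , final with reach-step C r z₀∈C w∈
... | z , ms , z∈C , refl , step =
  z , (r , ms) ∷ ps , z∈C , cong (r ∷_) reqs , cong₂ _+_ step cost , final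

optimal-steps-from : (c : Fin n) (α : List (Request n)) {y : Fin n} →
  lookup (candidates ⁅ c ⁆ α) y ≡ true →
  ∃ λ ps → requests ps ≡ α × costOf c ps ≡ pivotCost ⁅ c ⁆ α × finalCenter c ps ≡ y
optimal-steps-from c α y∈ with optimal-steps ⁅ c ⁆ α (lookup-⁅⁆-self c) y∈
... | z , ps , z∈ , rest with refl ← lookup-⁅⁆⇒≡ {a = c} {z} z∈ = ps , rest

price-≤-2 : ∀ b → price b ≤ 2
price-≤-2 true  = n≤1+n 1
price-≤-2 false = ≤-refl

price-≥-1 : ∀ b → 1 ≤ price b
price-≥-1 true  = ≤-refl
price-≥-1 false = n≤1+n 1

price-≤-stepCost-or-idle : ∀ C r (c : Fin n) ms →
  price (intersects C r) ≤ stepCost c (r , ms) ⊎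
  (ms ≡ [] × requested r c ≡ true × intersects C r ≡ false)
price-≤-stepCost-or-idle C r c (_ ∷ zs) =
  inj₁ (≤-trans (price-≤-2 _) (s≤s (≤-trans (price-≥-1 _) (m≤n+m _ (length zs)))))
price-≤-stepCost-or-idle C r c [] with requested r c | intersects C r
... | false | _     = inj₁ (price-≤-2 _)
... | true  | true  = inj₁ ≤-refl
... | true  | false = inj₂ (refl , refl , refl)

m≤n⇒n+o≡m+p⇒p≤o⇒n≡m : ∀ {m n o p} → m ≤ n → n + o ≡ m + p → p ≤ o → n ≡ m
m≤n⇒n+o≡m+p⇒p≤o⇒n≡m {m} {n} {o} {p} m≤n eq p≤o =
  ≤-antisym (+-cancelʳ-≤ o n m (≤-trans (≤-reflexive eq) (+-monoʳ-≤ m p≤o))) m≤n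

-- Phases

phaseGo-first : (e : Fin n) (R : List (Fin n)) → ∃₂ λ a rest → ∀ k → phaseGo e k R ≡ a + k ∷ rest
phaseGo-first e [] = 0 , [] , λ k → refl
phaseGo-first e (d ∷ R) with e == d
... | true  = let a , rest , eq = phaseGo-first e R
              in suc a , rest , λ k → trans (eq (suc k)) (cong (_∷ rest) (+-suc a k))
... | false = 0 , phaseGo d 1 R , λ k → refl

phaseGo-++ : ∀ (d : Fin n) k ds e R → ∃₂ λ Z j →
  phaseGo d (suc k) (ds ++ e ∷ R) ≡ Z ++ phaseGo e (if afterMigs d ds == e then suc (suc j) else 1) R
phaseGo-++ d k [] e R with d == e in d=e
... | true with refl ← ==⇒≡ {x = d} {e} d=e = [] , k , refl
... | false = suc k ∷ [] , 0 , refl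
phaseGo-++ d k (d′ ∷ ds) e R with d == d′ in d=d′
... | true with refl ← ==⇒≡ {x = d} {d′} d=d′ = phaseGo-++ d (suc k) ds e R
... | false = let Z , j , eq = phaseGo-++ d′ 0 ds e R in suc k ∷ Z , j , cong (suc k ∷_) eq

reverse-++-∷ : (xs : List A) (y : A) (ys : List A) →
  reverse (xs ++ y ∷ ys) ≡ reverse ys ++ y ∷ reverse xs
reverse-++-∷ xs y ys = begin
  reverse (xs ++ y ∷ ys)                ≡⟨ reverse-++ xs (y ∷ ys) ⟩
  reverse (y ∷ ys) ++ reverse xs        ≡⟨ cong (_++ reverse xs) (unfold-reverse y ys) ⟩
  (reverse ys ++ [ y ]) ++ reverse xs   ≡⟨ ++-assoc (reverse ys) [ y ] (reverse xs) ⟩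
  reverse ys ++ y ∷ reverse xs          ∎
  where open ≡-Reasoning

>⇒≰lex : ∀ P {a b : ℕ} X Y → b < a → ¬ (P ++ a ∷ X) ≤lex (P ++ b ∷ Y)
>⇒≰lex []      X Y b<a (<≤ a<b) = <-asym a<b b<a
>⇒≰lex []      X Y b<a (≡≤ _)   = <-irrefl refl b<a
>⇒≰lex (p ∷ P) X Y b<a (<≤ p<p) = <-irrefl refl p<p
>⇒≰lex (p ∷ P) X Y b<a (≡≤ le)  = >⇒≰lex P X Y b<a le

-- Both sequences agree from e on; on the left e continues a phase, on the right it starts one.
stayed-≰lex-moved : ∀ {e : Fin n} x xs x′ xs′ R → afterMigs x xs ≡ e → afterMigs x′ xs′ ≢ e →
  ¬ reverse (phaseLengths (x ∷ xs ++ e ∷ R)) ≤lex reverse (phaseLengths (x′ ∷ xs′ ++ e ∷ R))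
stayed-≰lex-moved {e = e} x xs x′ xs′ R stayed moved
  with phaseGo-++ x 0 xs e R | phaseGo-++ x′ 0 xs′ e R | phaseGo-first e R
... | Z , j , eq | Z′ , _ , eq′ | a , rest , first
  rewrite trans (cong (_== e) stayed) (==-refl e) | ≢⇒==-false moved =
  >⇒≰lex (reverse rest) (reverse Z) (reverse Z′) (+-monoʳ-< a (s≤s (s≤s z≤n)))
    ∘ subst₂ _≤lex_ (reversed Z eq) (reversed Z′ eq′)
  where
  reversed : ∀ {L} Z {k} → L ≡ Z ++ phaseGo e k R → reverse L ≡ reverse rest ++ a + k ∷ reverse Z
  reversed Z {k} eq = trans (cong reverse (trans eq (cong (Z ++_) (first k)))) (reverse-++-∷ Z (a + k) rest)

-- OPT* pays PivotTracking's charge on every request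

module Optimal {n m} {init : Fin n} {σ : Vec (Request n) m} {S : Schedule n m} (opt : IsOPT* init σ S) where

  C₀ : Subset n
  C₀ = ⁅ init ⁆

  steps : List (Step n)
  steps = toList (zip σ S)

  totalCost-steps : ∀ {S′ ps} → toList (zip σ S′) ≡ ps → totalCost init σ S′ ≡ costOf init ps
  totalCost-steps {S′} zipS′ = trans (totalCost-costOf init σ S′) (cong (costOf init) zipS′)

  centers-split : ∀ {S′} ps {r ms qs} → toList (zip σ S′) ≡ ps ++ (r , ms) ∷ qs →
    toList (centers init S′) ≡ centersOf init ps ++ centersOf (finalCenter init ps) ((r , ms) ∷ qs)
  centers-split {S′} ps split =
    trans (toList-centers init σ S′) (trans (cong (centersOf init) split) (centersOf-++ init ps _))

  optimal-cost : costOf init steps ≡ pivotCost C₀ (requests steps)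
  optimal-cost with candidates-nonempty C₀ (requests steps) (lookup-⁅⁆-self init)
  ... | _ , y∈ with optimal-steps-from init (requests steps) y∈
  ... | ps , reqs , cost , _ with schedule-from-steps σ ps (trans reqs (requests-zip σ S))
  ... | S′ , zipS′ = ≤-antisym (begin
    costOf init steps   ≡⟨ totalCost-steps refl ⟨
    totalCost init σ S  ≤⟨ proj₁ opt S′ ⟩
    totalCost init σ S′ ≡⟨ totalCost-steps zipS′ ⟩
    costOf init ps      ≡⟨ cost ⟩
    pivotCost C₀ (requests steps) ∎)
    (pivotCost-≤-costOf (lookup-⁅⁆-self init) steps)
    where open ≤-Reasoning

  reschedule : ∀ {ps r ms qs} ps′ ms′ → steps ≡ ps ++ (r , ms) ∷ qs → requests ps′ ≡ requests ps →
    ∃ λ S′ → toList (zip σ S′) ≡ ps′ ++ (r , ms′) ∷ qs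
  reschedule {ps} {r} {ms} {qs} ps′ ms′ split reqs = schedule-from-steps σ _ (begin
    requests (ps′ ++ (r , ms′) ∷ qs) ≡⟨ map-++ proj₁ ps′ _ ⟩
    requests ps′ ++ r ∷ requests qs  ≡⟨ cong (_++ r ∷ requests qs) reqs ⟩
    requests ps ++ r ∷ requests qs   ≡⟨ map-++ proj₁ ps _ ⟨
    requests (ps ++ (r , ms) ∷ qs)   ≡⟨ cong requests split ⟨
    requests steps                   ≡⟨ requests-zip σ S ⟩
    toList σ                         ∎)
    where open ≡-Reasoning

  no-idle-union : ∀ ps r qs → steps ≡ ps ++ (r , []) ∷ qs →
    requested r (finalCenter init ps) ≡ true → intersects (candidates C₀ (requests ps)) r ≡ false →
    costOf init ps ≢ suc (pivotCost C₀ (requests ps))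
  no-idle-union [] r qs _ _ _ ()
  no-idle-union ps@((_ , ms₀) ∷ ps₁) r qs split c-req miss overpaid
    with candidates-nonempty C₀ (requests ps) (lookup-⁅⁆-self init)
  ... | y , y∈ with optimal-steps-from init (requests ps) y∈
  ... | ps′@((_ , ms₀′) ∷ ps₁′) , reqs , cost , final
    with reschedule ps′ (finalCenter init ps ∷ []) split reqs
  ... | S′ , zipS′ =
    stayed-≰lex-moved x (centersOf x ps₁) x′ (centersOf x′ ps₁′) (centersOf c qs)
      (afterMigs-centersOf x ps₁)
      (λ moved=c → y≢c (trans (sym final) (trans (sym (afterMigs-centersOf x′ ps₁′)) moved=c)))
      (subst₂ _≤lex_ (cong (reverse ∘ phaseLengths) (centers-split ps split))
                     (cong (reverse ∘ phaseLengths) (centers-split ps′ zipS′))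
                     (proj₂ opt S′ same-cost))
    where
    c x x′ : Fin n
    c = finalCenter init ps
    x = afterMigs init ms₀
    x′ = afterMigs init ms₀′
    y≢c : y ≢ c
    y≢c y=c with () ← trans (sym (candidate-unrequested (candidates C₀ (requests ps)) r miss y∈))
                            (trans (cong (requested r) y=c) c-req)
    M T : ℕ
    M = pivotCost C₀ (requests ps)
    T = serveCost c r + costOf c qs
    same-cost : totalCost init σ S′ ≡ totalCost init σ S
    same-cost = begin
      totalCost init σ S′                     ≡⟨ totalCost-steps zipS′ ⟩
      costOf init (ps′ ++ (r , c ∷ []) ∷ qs)  ≡⟨ costOf-++ init ps′ _ ⟩
      costOf init ps′ + suc T                 ≡⟨ cong (_+ suc T) cost ⟩
      M + suc T                               ≡⟨ +-suc M T ⟩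
      suc M + T                               ≡⟨ cong (_+ T) overpaid ⟨
      costOf init ps + T                      ≡⟨ costOf-++ init ps _ ⟨
      costOf init (ps ++ (r , []) ∷ qs)       ≡⟨ totalCost-steps split ⟨
      totalCost init σ S                      ∎
      where open ≡-Reasoning

  mutual
    prefix-cost : ∀ ps qs → steps ≡ ps ++ qs → costOf init ps ≡ pivotCost C₀ (requests ps)
    prefix-cost ps [] split =
      subst (λ ps → costOf init ps ≡ pivotCost C₀ (requests ps))
            (trans split (++-identityʳ ps)) optimal-cost
    prefix-cost ps ((r , ms) ∷ qs) split
      with price-≤-stepCost-or-idle (candidates C₀ (requests ps)) r (finalCenter init ps) ms
    ... | inj₁ charge≤paid =
      m≤n⇒n+o≡m+p⇒p≤o⇒n≡m (pivotCost-≤-costOf (lookup-⁅⁆-self init) ps)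
                          (step-balance ps _ qs split) charge≤paid
    ... | inj₂ (refl , c-req , miss) = contradiction overpaid (no-idle-union ps r qs split c-req miss)
      where
      overpaid : costOf init ps ≡ suc (pivotCost C₀ (requests ps))
      overpaid = +-cancelʳ-≡ 1 _ _ (trans
        (subst₂ (λ v h → costOf init ps + price v ≡ pivotCost C₀ (requests ps) + price h) c-req miss
                (step-balance ps _ qs split))
        (+-suc _ 1))

    step-balance : ∀ ps p qs → steps ≡ ps ++ p ∷ qs →
      costOf init ps + stepCost (finalCenter init ps) p ≡
      pivotCost C₀ (requests ps) + price (intersects (candidates C₀ (requests ps)) (proj₁ p))
    step-balance ps p qs split = begin
      costOf init ps + stepCost (finalCenter init ps) p ≡⟨ costOf-snoc init ps p ⟨
      costOf init (ps ++ [ p ])                          ≡⟨ prefix-cost (ps ++ [ p ]) qs split′ ⟩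
      pivotCost C₀ (requests (ps ++ [ p ]))              ≡⟨ cong (pivotCost C₀) (map-++ proj₁ ps [ p ]) ⟩
      pivotCost C₀ (requests ps ++ [ proj₁ p ])          ≡⟨ pivotCost-snoc C₀ (requests ps) (proj₁ p) ⟩
      pivotCost C₀ (requests ps) + price (intersects (candidates C₀ (requests ps)) (proj₁ p)) ∎
      where
      open ≡-Reasoning
      split′ : steps ≡ (ps ++ [ p ]) ++ qs
      split′ = trans split (sym (++-assoc ps [ p ] qs))

  step-cost : ∀ ps p qs → steps ≡ ps ++ p ∷ qs →
    stepCost (finalCenter init ps) p ≡ price (intersects (candidates C₀ (requests ps)) (proj₁ p))
  step-cost ps p qs split = +-cancelˡ-≡ (pivotCost C₀ (requests ps)) _ _
    (trans (cong (_+ stepCost (finalCenter init ps) p) (sym (prefix-cost ps (p ∷ qs) split)))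
           (step-balance ps p qs split))

  lookup-stepCost : ∀ i →
    stepCost (finalCenter init (take (toℕ i) steps)) (lookup σ i , lookup S i) ≡
    price (intersects (candidates C₀ (take (toℕ i) (toList σ))) (lookup σ i))
  lookup-stepCost i = trans (step-cost before _ after split)
    (cong (λ α → price (intersects (candidates C₀ α) (lookup σ i))) requests-before)
    where
    before after : List (Step n)
    before = take (toℕ i) steps
    after = drop (suc (toℕ i)) steps
    split : steps ≡ before ++ (lookup σ i , lookup S i) ∷ after
    split = trans (toList-split (zip σ S) i) (cong (λ p → before ++ p ∷ after) (lookup-zip i σ S))
    requests-before : requests before ≡ take (toℕ i) (toList σ)
    requests-before = trans (sym (take-map (toℕ i) steps)) (cong (take (toℕ i)) (requests-zip σ S))

behaviour⇔cost : ∀ h v {b L s} → b ≡ behaviour h → s ≡ price v → L + s ≡ price h →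
  ((b ≡ intersection) ⇔ (L + s ≡ 1)) ×
  ((b ≡ union) ⇔ ((L + s ≡ 2) × ((L ≡ 0 × s ≡ 2) ⊎ (L ≡ 1 × s ≡ 1))))
behaviour⇔cost true  _ refl refl paid =
  mk⇔ (λ _ → paid) (λ _ → refl) ,
  mk⇔ (λ ()) (λ (paid₂ , _) → contradiction (trans (sym paid₂) paid) λ ())
behaviour⇔cost false v {L = L} refl refl paid =
  mk⇔ (λ ()) (λ paid₁ → contradiction (trans (sym paid₁) paid) λ ()) ,
  mk⇔ (λ _ → paid , split v paid) (λ _ → refl)
  where
  split : ∀ v → L + price v ≡ 2 → (L ≡ 0 × price v ≡ 2) ⊎ (L ≡ 1 × price v ≡ 1)
  split true  paid = inj₂ (+-cancelʳ-≡ 1 L 1 paid , refl)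
  split false paid = inj₁ (+-cancelʳ-≡ 2 L 0 paid , refl)

lemma2 : ∀ {n m} (init : Fin n) (σ : Vec (Request n) m) (S : Schedule n m) →
    IsOPT* init σ S → (i : Fin m) →
      ((lookup (pivotBehaviour init σ) i ≡ intersection) ⇔ (reqCost init σ S i ≡ 1)) ×
      ((lookup (pivotBehaviour init σ) i ≡ union) ⇔
        ((reqCost init σ S i ≡ 2) ×
         ((migCost S i ≡ 0 × servCost init σ S i ≡ 2) ⊎ (migCost S i ≡ 1 × servCost init σ S i ≡ 1))))
lemma2 {n} init σ S opt i =
  behaviour⇔cost (intersects (candidates ⁅ init ⁆ (take (toℕ i) (toList σ))) (lookup σ i))
                 (requested (lookup σ i) center)
                 (lookup-pivotRun ⁅ init ⁆ init σ i)
                 (cong serve (lookup-centers init σ S i))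
                 (trans (cong (λ c → length (lookup S i) + serve c) (lookup-centers init σ S i))
                        (Optimal.lookup-stepCost opt i))
  where
  center : Fin n
  center = afterMigs (finalCenter init (take (toℕ i) (toList (zip σ S)))) (lookup S i)
  serve : Fin n → ℕ
  serve c = serveCost c (lookup σ i)
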